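{- Let $n\ge 2$ and let $\mathcal{A}_n$ be the set of arrays defined below. For any $A\in\mathcal{A}_n$, $A$ can be reconstructed from the answers to the queries $\mathsf{RMin}(i,j,q)$ and $\mathsf{RMax}(i,j,q)$ on $A$ (over all $1\le i\le j\le n$ and $q\ge1$); equivalently, any two distinct arrays in $\mathcal{A}_n$ differ in the answer to at least one such query.
   Context: A permutation $\pi$ of $\{1,\dots,m\}$ is a Baxter permutation if it avoids the patterns $2\text{ - }41\text{ - }3$ and $3\text{ - }14\text{ - }2$: there are no indices $a<b<b+1<c$ with $\pi(b+1)<\pi(a)<\pi(c)<\pi(b)$, and no indices $a<b<b+1<c$ with $\pi(b)<\pi(c)<\pi(a)<\pi(b+1)$. $\mathcal{A}_n$ is the set of all arrays $A[1..n]$ obtained as follows: choose $0\le k\le n-1$ and a set $P$ of $k$ positions in $\{2,\dots,n\}$; place a Baxter permutation of size $n-k$ (values $1,\dots,n-k$) in order on the $n-k$ positions of $\{1,\dots,n\}\setminus P$; then each position in $P$ is assigned the value at the nearest position of $\{1,\dots,n\}\setminus P$ to its left. Queries: for an interval $[i,j]$, let $i\le p_1<\dots<p_k\le j$ be all positions of the minimum value of $A[i..j]$; $\mathsf{RMin}(i,j,q)$ returns $p_q$ (or $p_k$ if $q>k$); $\mathsf{RMax}(i,j,q)$ is analogous with maximum. -}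

module Defs where

open import Data.Nat using (ℕ; zero; suc; _≤_; _<_; _⊓_; _⊔_; _∸_; _≡ᵇ_; _≤ᵇ_)
open import Data.Bool using (Bool; true; false; not; _∧_)
open import Data.Fin using (Fin; toℕ)
open import Data.Fin.Permutation using (Permutation′; _⟨$⟩ʳ_)
open import Data.List using (List; []; _∷_; filter; length; foldr; map)
open import Data.List.Base using (allFin)
open import Data.Maybe using (Maybe; just; nothing)
open import Data.Product using (Σ; _×_; ∃)
open import Relation.Binary.PropositionalEquality using (_≡_)
open import Relation.Nullary using (¬_)
open import Relation.Nullary.Decidable using (does)
open import Data.Bool using (T)

-- Arrays A[1..n] are modelled 0-indexed: position p ∈ Fin n stands for p+1.
Array : ℕ → Set
Array n = Fin n → ℕ

-- Baxter permutations of {1..m}, modelled 0-indexed as permutations of Fin m.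
-- π avoids 2-41-3 and 3-14-2 (b' is the index b+1).
IsBaxter : {m : ℕ} → Permutation′ m → Set
IsBaxter {m} π =
  (a b b' c : Fin m) → toℕ a < toℕ b → toℕ b' ≡ suc (toℕ b) → toℕ b' < toℕ c →
    ¬ ( (toℕ (π ⟨$⟩ʳ b') < toℕ (π ⟨$⟩ʳ a)) × (toℕ (π ⟨$⟩ʳ a) < toℕ (π ⟨$⟩ʳ c))
        × (toℕ (π ⟨$⟩ʳ c) < toℕ (π ⟨$⟩ʳ b)) )
  × ¬ ( (toℕ (π ⟨$⟩ʳ b) < toℕ (π ⟨$⟩ʳ c)) × (toℕ (π ⟨$⟩ʳ c) < toℕ (π ⟨$⟩ʳ a))
        × (toℕ (π ⟨$⟩ʳ a) < toℕ (π ⟨$⟩ʳ b')) )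

countFree≤ : {n : ℕ} → (Fin n → Bool) → Fin n → ℕ
countFree≤ {n} P i = length (filter (λ j → T? (not (P j) ∧ (toℕ j ≤ᵇ toℕ i))) (allFin n))
  where
  open import Data.Bool.Properties using (T?)

countFree : {n : ℕ} → (Fin n → Bool) → ℕ
countFree {n} P = length (filter (λ j → T? (not (P j))) (allFin n))
  where
  open import Data.Bool.Properties using (T?)

-- A ∈ 𝒜_n iff there is a set P of positions not containing the
-- first position, and a Baxter permutation π of size m = n - |P|, such that the
-- value at every position i is π applied to the rank r (0-based) of the nearest
-- free position at or to the left of i, i.e. r + 1 = #free positions ≤ i.
-- (Values are 1-based: π(r) + 1.)
InA : (n : ℕ) → Array n → Set
InA n A =
  Σ (Fin n → Bool) λ P →
  Σ ℕ λ m →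
  Σ (Permutation′ m) λ π →
    ((z : Fin n) → toℕ z ≡ 0 → P z ≡ false)
  × (m ≡ countFree P)
  × IsBaxter π
  × ((i : Fin n) (r : Fin m) → suc (toℕ r) ≡ countFree≤ P i →
       A i ≡ suc (toℕ (π ⟨$⟩ʳ r)))

range : {n : ℕ} → Fin n → Fin n → List (Fin n)
range {n} i j = filter (λ p → T? ((toℕ i ≤ᵇ toℕ p) ∧ (toℕ p ≤ᵇ toℕ j))) (allFin n)
  where
  open import Data.Bool.Properties using (T?)

select : {X : Set} → ℕ → List X → Maybe X
select _ [] = nothing
select zero (x ∷ _) = just x
select (suc q) (x ∷ []) = just x
select (suc q) (x ∷ y ∷ xs) = select q (y ∷ xs)

minIn : {n : ℕ} → Array n → Fin n → Fin n → ℕ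
minIn A i j = foldr (λ p acc → A p ⊓ acc) (A i) (range i j)

maxIn : {n : ℕ} → Array n → Fin n → Fin n → ℕ
maxIn A i j = foldr (λ p acc → A p ⊔ acc) (A i) (range i j)

RMin : {n : ℕ} → Array n → Fin n → Fin n → ℕ → Maybe (Fin n)
RMin A i j q = select (q ∸ 1) (filter (λ p → T? (A p ≡ᵇ minIn A i j)) (range i j))
  where
  open import Data.Bool.Properties using (T?)

RMax : {n : ℕ} → Array n → Fin n → Fin n → ℕ → Maybe (Fin n)
RMax A i j q = select (q ∸ 1) (filter (λ p → T? (A p ≡ᵇ maxIn A i j)) (range i j))
  where
  open import Data.Bool.Properties using (T?)

{-# OPTIONS --safe #-}
module Submission where

-- The copy positions are recovered first: position
-- i+1 is a copy exactly when A[i] = A[i+1] (the values at distinct free positions differ),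
-- and A[i] = A[i+1] exactly when RMin(i,i+1,1) = RMax(i,i+1,1) = i. So both arrays share
-- the copy set P, and it remains to show that the Baxter permutations f and g read along
-- the free positions are order-isomorphic. Querying the block between the free positions
-- of ranks r < s shows that g r ≤ g s whenever f r is the minimum of f on [r, s] or f s is
-- the strict maximum of f on [r, s). By induction on s − r, an ascent f r < f s is also an
-- ascent of g: otherwise the induction hypothesis puts every f t with r < t < s below f r
-- or above f s; if all lie above, or all below, the query transfer contradicts g s < g r,
-- and otherwise two neighbours t, t+1 lie on opposite sides, which is a 2-41-3 in f or,
-- through the induction hypothesis, a 3-14-2 in g.

open import Defs
open import Data.Nat using (ℕ; zero; suc; pred; _+_; _≤_; _<_; _∸_; _≤ᵇ_; _≡ᵇ_; _⊓_; _⊔_; z≤n; s≤s; s≤s⁻¹; _≤?_; _<?_; >-nonZero)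
open import Data.Nat.Properties
open import Data.Nat.Induction using (<-rec)
open import Data.Bool using (Bool; true; false; not; _∧_; T)
open import Data.Bool.Properties using (T?; T-∧; ∧-identityʳ; ∧-zeroʳ; ¬-not; ⇔→≡)
open import Data.Fin using (Fin; toℕ; fromℕ; fromℕ<; inject₁) renaming (zero to fzero; suc to fsuc)
open import Data.Fin.Properties using (toℕ-injective; toℕ<n; toℕ-fromℕ<; toℕ≤pred[n]; toℕ-inject₁; toℕ-fromℕ) renaming (suc-injective to fsuc-injective)
open import Data.Fin.Permutation using (Permutation′; _⟨$⟩ʳ_; _⟨$⟩ˡ_; inverseˡ; inverseʳ)
open import Data.List using (List; []; _∷_; filter; length; tabulate; foldr; allFin)
open import Data.List.Membership.Propositional using (_∈_)
open import Data.List.Membership.Propositional.Properties using (∈-filter⁺; ∈-filter⁻; ∈-allFin)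
open import Data.List.Relation.Unary.Any using (here; there)
open import Data.Maybe using (just)
open import Data.Product using (Σ; _×_; _,_; proj₁; proj₂; uncurry)
open import Data.Sum using (_⊎_; inj₁; inj₂; [_,_]) renaming (map to ⊎-map)
open import Data.Empty using (⊥; ⊥-elim)
open import Function using (_∘_; id)
open import Relation.Binary.PropositionalEquality hiding ([_])
open import Relation.Binary.Definitions using (tri<; tri≈; tri>)
open import Relation.Nullary using (¬_; yes; no)
open import Relation.Unary using (_⊆_)
open import Relation.Nullary.Decidable using (dec-true; dec-false)
open import Function.Bundles using (Equivalence; _⇔_; mk⇔)
open import Function.Properties.Equivalence using () renaming (refl to ⇔-refl; sym to ⇔-sym; trans to ⇔-trans)
open import Algebra.Properties.CommutativeSemigroup +-commutativeSemigroup using (xy∙z≈zy∙x)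

bit : Bool → ℕ
bit true  = 1
bit false = 0

count : ∀ {n} → (Fin n → Bool) → ℕ
count {zero}  f = 0
count {suc n} f = bit (f fzero) + count (f ∘ fsuc)

length-filter-tabulate : ∀ {A : Set} {n} (g : Fin n → A) (h : A → Bool) →
  length (filter (T? ∘ h) (tabulate g)) ≡ count (h ∘ g)
length-filter-tabulate {n = zero}  g h = refl
length-filter-tabulate {n = suc n} g h with h (g fzero)
... | true  = cong suc (length-filter-tabulate (g ∘ fsuc) h)
... | false = length-filter-tabulate (g ∘ fsuc) h

bit-mono : ∀ {a b} → (T a → T b) → bit a ≤ bit b
bit-mono {true}  {true}  _   = ≤-refl
bit-mono {true}  {false} a⇒b = ⊥-elim (a⇒b _)
bit-mono {false}         _   = z≤n

count-cong : ∀ {n} {f g : Fin n → Bool} → (∀ j → f j ≡ g j) → count f ≡ count g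
count-cong {zero}  f≗g = refl
count-cong {suc n} f≗g = cong₂ _+_ (cong bit (f≗g fzero)) (count-cong (f≗g ∘ fsuc))

count-mono : ∀ {n} {f g : Fin n → Bool} → T ∘ f ⊆ T ∘ g → count f ≤ count g
count-mono {zero}  f⊆g = z≤n
count-mono {suc n} f⊆g = +-mono-≤ (bit-mono (f⊆g {fzero})) (count-mono λ {j} → f⊆g {fsuc j})

count-mono-< : ∀ {n} {f g : Fin n → Bool} → T ∘ f ⊆ T ∘ g →
  (x : Fin n) → f x ≡ false → g x ≡ true → count f < count g
count-mono-< f⊆g fzero fx gx rewrite fx | gx = s≤s (count-mono λ {j} → f⊆g {fsuc j})
count-mono-< f⊆g (fsuc x) fx gx = +-mono-≤-< (bit-mono (f⊆g {fzero})) (count-mono-< (λ {j} → f⊆g {fsuc j}) x fx gx)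

count-update : ∀ {n} {f g : Fin n → Bool} (x : Fin n) → (∀ j → j ≢ x → f j ≡ g j) →
  count f + bit (g x) ≡ count g + bit (f x)
count-update {f = f} {g} fzero f≗g
  rewrite count-cong {f = f ∘ fsuc} {g ∘ fsuc} (λ j → f≗g (fsuc j) λ ()) =
  xy∙z≈zy∙x (bit (f fzero)) (count (g ∘ fsuc)) (bit (g fzero))
count-update {f = f} {g} (fsuc x) f≗g rewrite f≗g fzero (λ ()) =
  trans (+-assoc (bit (g fzero)) _ _)
    (trans (cong (bit (g fzero) +_) (count-update x λ j j≢x → f≗g (fsuc j) (j≢x ∘ fsuc-injective)))
      (sym (+-assoc (bit (g fzero)) _ _)))

count-const-false : ∀ {n} → count {n} (λ _ → false) ≡ 0
count-const-false {zero}  = refl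
count-const-false {suc n} = count-const-false {n}

firstOf : ∀ {n} → Fin n → Fin n
firstOf fzero    = fzero
firstOf (fsuc _) = fzero

toℕ-firstOf : ∀ {n} (i : Fin n) → toℕ (firstOf i) ≡ 0
toℕ-firstOf fzero    = refl
toℕ-firstOf (fsuc _) = refl

FirstFree : ∀ {n} → (Fin n → Bool) → Set
FirstFree {n} P = (z : Fin n) → toℕ z ≡ 0 → P z ≡ false

module FreePositions {n : ℕ} (P : Fin n → Bool) where

  freeUpTo : Fin n → Fin n → Bool
  freeUpTo i j = not (P j) ∧ (toℕ j ≤ᵇ toℕ i)

  #free≤ : Fin n → ℕ
  #free≤ i = count (freeUpTo i)

  #free : ℕ
  #free = count (not ∘ P)

  countFree≤≡#free≤ : ∀ i → countFree≤ P i ≡ #free≤ i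
  countFree≤≡#free≤ i = length-filter-tabulate id (freeUpTo i)

  countFree≡#free : countFree P ≡ #free
  countFree≡#free = length-filter-tabulate id (not ∘ P)

  freeUpTo-≤ : ∀ {i j} → toℕ j ≤ toℕ i → freeUpTo i j ≡ not (P j)
  freeUpTo-≤ {i} {j} j≤i = trans (cong (not (P j) ∧_) (dec-true (toℕ j ≤? toℕ i) j≤i)) (∧-identityʳ _)

  freeUpTo-> : ∀ {i j} → toℕ i < toℕ j → freeUpTo i j ≡ false
  freeUpTo-> {i} {j} i<j = trans (cong (not (P j) ∧_) (dec-false (toℕ j ≤? toℕ i) (<⇒≱ i<j))) (∧-zeroʳ _)

  freeUpTo-mono : ∀ {x y} → toℕ x ≤ toℕ y → T ∘ freeUpTo x ⊆ T ∘ freeUpTo y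
  freeUpTo-mono {x} {y} x≤y {j} t with Equivalence.to T-∧ t
  ... | free , j≤ᵇx = Equivalence.from T-∧ (free , ≤⇒≤ᵇ (≤-trans (≤ᵇ⇒≤ (toℕ j) (toℕ x) j≤ᵇx) x≤y))

  freeUpTo⊆free : ∀ {x} → T ∘ freeUpTo x ⊆ T ∘ (not ∘ P)
  freeUpTo⊆free t = proj₁ (Equivalence.to T-∧ t)

  #free≤-mono : ∀ {x y} → toℕ x ≤ toℕ y → #free≤ x ≤ #free≤ y
  #free≤-mono {x} {y} x≤y = count-mono {f = freeUpTo x} {freeUpTo y} (freeUpTo-mono x≤y)

  #free≤-mono-< : ∀ {x y} → toℕ x < toℕ y → P y ≡ false → #free≤ x < #free≤ y
  #free≤-mono-< {x} {y} x<y Py = count-mono-< {f = freeUpTo x} {freeUpTo y} (freeUpTo-mono (<⇒≤ x<y)) y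
    (freeUpTo-> x<y) (trans (freeUpTo-≤ ≤-refl) (cong not Py))

  #free≤-≤-#free : ∀ x → #free≤ x ≤ #free
  #free≤-≤-#free x = count-mono {f = freeUpTo x} {not ∘ P} freeUpTo⊆free

  #free≤-last : ∀ x → toℕ x ≡ pred n → #free≤ x ≡ #free
  #free≤-last x x≡last = count-cong λ j → freeUpTo-≤ (subst (toℕ j ≤_) (sym x≡last) (toℕ≤pred[n] j))

  #free≤-suc : ∀ {x y} → toℕ y ≡ suc (toℕ x) → #free≤ y ≡ #free≤ x + bit (not (P y))
  #free≤-suc {x} {y} y≡1+x = begin
    #free≤ y                            ≡⟨ +-identityʳ _ ⟨
    #free≤ y + bit false                ≡⟨ cong (λ b → #free≤ y + bit b) (freeUpTo-> x<y) ⟨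
    #free≤ y + bit (freeUpTo x y)       ≡⟨ count-update {f = freeUpTo x} {freeUpTo y} y agree ⟨
    #free≤ x + bit (freeUpTo y y)       ≡⟨ cong (λ b → #free≤ x + bit b) (freeUpTo-≤ ≤-refl) ⟩
    #free≤ x + bit (not (P y))          ∎
    where
    open ≡-Reasoning
    x<y : toℕ x < toℕ y
    x<y = subst (toℕ x <_) (sym y≡1+x) ≤-refl
    agree : ∀ j → j ≢ y → freeUpTo x j ≡ freeUpTo y j
    agree j j≢y with toℕ j ≤? toℕ x
    ... | yes j≤x = trans (freeUpTo-≤ j≤x) (sym (freeUpTo-≤ (≤-trans j≤x (<⇒≤ x<y))))
    ... | no  j≰x = trans (freeUpTo-> (≰⇒> j≰x)) (sym (freeUpTo-> y<j))
      where
      y<j : toℕ y < toℕ j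
      y<j = ≤∧≢⇒< (subst (_≤ toℕ j) (sym y≡1+x) (≰⇒> j≰x)) (λ y≡j → j≢y (toℕ-injective (sym y≡j)))

  #free≤-first : ∀ z → toℕ z ≡ 0 → #free≤ z ≤ 1
  #free≤-first z z≡0 = subst (_≤ 1) (sym counted) (bit≤1 (freeUpTo z z))
    where
    bit≤1 : ∀ b → bit b ≤ 1
    bit≤1 true  = ≤-refl
    bit≤1 false = z≤n
    others : ∀ j → j ≢ z → freeUpTo z j ≡ false
    others j j≢z = freeUpTo-> (subst (_< toℕ j) (sym z≡0)
      (n≢0⇒n>0 λ j≡0 → j≢z (toℕ-injective (trans j≡0 (sym z≡0)))))
    counted : #free≤ z ≡ bit (freeUpTo z z)
    counted = begin
      #free≤ z                                       ≡⟨ +-identityʳ _ ⟨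
      #free≤ z + bit false                           ≡⟨ count-update {f = freeUpTo z} {λ _ → false} z others ⟩
      count {n} (λ _ → false) + bit (freeUpTo z z)   ≡⟨ cong (_+ bit (freeUpTo z z)) (count-const-false {n}) ⟩
      bit (freeUpTo z z)                             ∎
      where open ≡-Reasoning

  #free≤-positive : FirstFree P → ∀ x → 1 ≤ #free≤ x
  #free≤-positive firstFree x = subst (_< #free≤ x) (count-const-false {n})
    (count-mono-< {f = λ _ → false} {freeUpTo x} (λ ()) (firstOf x) refl
      (trans (freeUpTo-≤ (subst (_≤ toℕ x) (sym (toℕ-firstOf x)) z≤n))
             (cong not (firstFree (firstOf x) (toℕ-firstOf x)))))

  #free≤-attains : FirstFree P → ∀ t x → toℕ x ≡ t → ∀ {k} → 1 ≤ k → k ≤ #free≤ x →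
    Σ (Fin n) λ i → P i ≡ false × #free≤ i ≡ k
  #free≤-attains firstFree zero x x≡0 1≤k k≤x =
    x , firstFree x x≡0 , ≤-antisym (≤-trans (#free≤-first x x≡0) 1≤k) k≤x
  #free≤-attains firstFree (suc t) x x≡1+t {k} 1≤k k≤x =
    fromPredecessor (fromℕ< t<n) (trans x≡1+t (cong suc (sym (toℕ-fromℕ< t<n))))
    where
    t<n : t < n
    t<n = <-trans (subst (t <_) (sym x≡1+t) ≤-refl) (toℕ<n x)
    fromPredecessor : ∀ x' → toℕ x ≡ suc (toℕ x') → Σ (Fin n) λ i → P i ≡ false × #free≤ i ≡ k
    fromPredecessor x' x≡1+x' with k ≤? #free≤ x' | P x in Px | #free≤-suc {x'} {x} x≡1+x'
    ... | yes k≤x' | _     | _    =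
      #free≤-attains firstFree t x' (suc-injective (trans (sym x≡1+x') x≡1+t)) 1≤k k≤x'
    ... | no  k≰x' | true  | step = ⊥-elim (k≰x' (subst (k ≤_) (trans step (+-identityʳ _)) k≤x))
    ... | no  k≰x' | false | step =
      x , Px , ≤-antisym (subst (_≤ k) (trans (+-comm 1 _) (sym step)) (≰⇒> k≰x')) k≤x

open FreePositions

#free≤-surjective : ∀ {n} (P : Fin n → Bool) → FirstFree P → ∀ {k} → 1 ≤ k → k ≤ #free P →
  Σ (Fin n) λ i → P i ≡ false × #free≤ P i ≡ k
#free≤-surjective {zero}  P firstFree 1≤k k≤0 = ⊥-elim (<⇒≱ 1≤k k≤0)
#free≤-surjective {suc n} P firstFree {k} 1≤k k≤ =
  #free≤-attains P firstFree n (fromℕ n) (toℕ-fromℕ n) 1≤k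
    (subst (k ≤_) (sym (#free≤-last P (fromℕ n) (toℕ-fromℕ n))) k≤)

value : ∀ {m} → Permutation′ m → Fin m → ℕ
value π r = toℕ (π ⟨$⟩ʳ r)

value-injective : ∀ {m} (π : Permutation′ m) {r s} → value π r ≡ value π s → r ≡ s
value-injective π {r} {s} eq = begin
  r                     ≡⟨ inverseˡ π ⟨
  π ⟨$⟩ˡ (π ⟨$⟩ʳ r)     ≡⟨ cong (π ⟨$⟩ˡ_) (toℕ-injective eq) ⟩
  π ⟨$⟩ˡ (π ⟨$⟩ʳ s)     ≡⟨ inverseˡ π ⟩
  s                     ∎
  where open ≡-Reasoning

record ValuedBy {n m} (P : Fin n → Bool) (π : Permutation′ m) (X : Array n) : Set where
  constructor valuedBy
  field valued-at : (i : Fin n) (r : Fin m) → suc (toℕ r) ≡ countFree≤ P i → X i ≡ suc (value π r)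

ValuedBy-cong : ∀ {n m} {P Q : Fin n → Bool} {π : Permutation′ m} {X} →
  (∀ j → P j ≡ Q j) → ValuedBy Q π X → ValuedBy P π X
ValuedBy-cong {P = P} {Q} P≗Q (valuedBy valued) = valuedBy λ i r 1+r≡ → valued i r (begin
  suc (toℕ r)     ≡⟨ 1+r≡ ⟩
  countFree≤ P i  ≡⟨ countFree≤≡#free≤ P i ⟩
  #free≤ P i      ≡⟨ count-cong (λ j → cong (λ b → not b ∧ _) (P≗Q j)) ⟩
  #free≤ Q i      ≡⟨ countFree≤≡#free≤ Q i ⟨
  countFree≤ Q i  ∎)
  where open ≡-Reasoning

countFree-cong : ∀ {n} {P Q : Fin n → Bool} → (∀ j → P j ≡ Q j) → countFree P ≡ countFree Q
countFree-cong {P = P} {Q} P≗Q =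
  trans (countFree≡#free P) (trans (count-cong (cong not ∘ P≗Q)) (sym (countFree≡#free Q)))

module Ranks {n : ℕ} (P : Fin n → Bool) (firstFree : FirstFree P) {m : ℕ} (m≡ : m ≡ countFree P) where

  m≡#free : m ≡ #free P
  m≡#free = trans m≡ (countFree≡#free P)

  suc-pred-#free≤ : ∀ x → suc (pred (#free≤ P x)) ≡ #free≤ P x
  suc-pred-#free≤ x = suc-pred (#free≤ P x) {{>-nonZero (#free≤-positive P firstFree x)}}

  pred-#free≤<m : ∀ x → pred (#free≤ P x) < m
  pred-#free≤<m x = subst₂ _≤_ (sym (suc-pred-#free≤ x)) (sym m≡#free) (#free≤-≤-#free P x)

  rank : Fin n → Fin m
  rank x = fromℕ< (pred-#free≤<m x)

  suc-rank : ∀ x → suc (toℕ (rank x)) ≡ #free≤ P x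
  suc-rank x = trans (cong suc (toℕ-fromℕ< (pred-#free≤<m x))) (suc-pred-#free≤ x)

  rank-mono : ∀ {x y} → toℕ x ≤ toℕ y → toℕ (rank x) ≤ toℕ (rank y)
  rank-mono {x} {y} x≤y = s≤s⁻¹ (subst₂ _≤_ (sym (suc-rank x)) (sym (suc-rank y)) (#free≤-mono P x≤y))

  rank-mono-< : ∀ {x y} → toℕ x < toℕ y → P y ≡ false → toℕ (rank x) < toℕ (rank y)
  rank-mono-< {x} {y} x<y Py = s≤s⁻¹ (subst₂ _<_ (sym (suc-rank x)) (sym (suc-rank y)) (#free≤-mono-< P x<y Py))

  rank-cancel-< : ∀ {x y} → toℕ (rank x) < toℕ (rank y) → toℕ x < toℕ y
  rank-cancel-< {x} {y} r<r' = ≰⇒> λ y≤x → <⇒≱ r<r' (rank-mono y≤x)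

  rank-copied : ∀ {x y} → toℕ y ≡ suc (toℕ x) → P y ≡ true → rank x ≡ rank y
  rank-copied {x} {y} y≡1+x Py = toℕ-injective (suc-injective (begin
    suc (toℕ (rank x))            ≡⟨ suc-rank x ⟩
    #free≤ P x                    ≡⟨ +-identityʳ _ ⟨
    #free≤ P x + bit (not true)   ≡⟨ cong (λ b → #free≤ P x + bit (not b)) Py ⟨
    #free≤ P x + bit (not (P y))  ≡⟨ #free≤-suc P y≡1+x ⟨
    #free≤ P y                    ≡⟨ suc-rank y ⟨
    suc (toℕ (rank y))            ∎))
    where open ≡-Reasoning

  free-with-rank : ∀ r → Σ (Fin n) λ i → P i ≡ false × #free≤ P i ≡ suc (toℕ r)
  free-with-rank r = #free≤-surjective P firstFree (s≤s z≤n) (subst (suc (toℕ r) ≤_) m≡#free (toℕ<n r))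

  position : Fin m → Fin n
  position r = proj₁ (free-with-rank r)

  position-free : ∀ r → P (position r) ≡ false
  position-free r = proj₁ (proj₂ (free-with-rank r))

  rank-position : ∀ r → rank (position r) ≡ r
  rank-position r = toℕ-injective (suc-injective (trans (suc-rank (position r)) (proj₂ (proj₂ (free-with-rank r)))))

  position-mono-< : ∀ {r s} → toℕ r < toℕ s → toℕ (position r) < toℕ (position s)
  position-mono-< {r} {s} r<s =
    rank-cancel-< (subst₂ (λ a b → toℕ a < toℕ b) (sym (rank-position r)) (sym (rank-position s)) r<s)

  position≤⇒≤rank : ∀ {r p} → toℕ (position r) ≤ toℕ p → toℕ r ≤ toℕ (rank p)
  position≤⇒≤rank {r} pos≤p = subst (λ u → toℕ u ≤ _) (rank-position r) (rank-mono pos≤p)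

  ≤position⇒rank≤ : ∀ {p s} → toℕ p ≤ toℕ (position s) → toℕ (rank p) ≤ toℕ s
  ≤position⇒rank≤ {s = s} p≤pos = subst (λ u → _ ≤ toℕ u) (rank-position s) (rank-mono p≤pos)

  <position⇒rank< : ∀ {p s} → toℕ p < toℕ (position s) → toℕ (rank p) < toℕ s
  <position⇒rank< {s = s} p<pos = subst (λ u → _ < toℕ u) (rank-position s) (rank-mono-< p<pos (position-free s))

  module Valued {π : Permutation′ m} {X : Array n} (valued : ValuedBy P π X) where

    valued-rank : ∀ x → X x ≡ suc (value π (rank x))
    valued-rank x = ValuedBy.valued-at valued x (rank x) (trans (suc-rank x) (sym (countFree≤≡#free≤ P x)))

    valued-position : ∀ r → X (position r) ≡ suc (value π r)
    valued-position r = trans (valued-rank (position r)) (cong (suc ∘ value π) (rank-position r))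

    copied⇒equal : ∀ {x y} → toℕ y ≡ suc (toℕ x) → P y ≡ true → X x ≡ X y
    copied⇒equal {x} {y} y≡1+x Py = begin
      X x                       ≡⟨ valued-rank x ⟩
      suc (value π (rank x))    ≡⟨ cong (suc ∘ value π) (rank-copied y≡1+x Py) ⟩
      suc (value π (rank y))    ≡⟨ valued-rank y ⟨
      X y                       ∎
      where open ≡-Reasoning

    free⇒distinct : ∀ {x y} → toℕ y ≡ suc (toℕ x) → P y ≡ false → X x ≢ X y
    free⇒distinct {x} {y} y≡1+x Py Xx≡Xy = <⇒≢ (rank-mono-< x<y Py)
      (cong toℕ (value-injective π (suc-injective (trans (sym (valued-rank x)) (trans Xx≡Xy (valued-rank y))))))
      where
      x<y : toℕ x < toℕ y
      x<y = subst (toℕ x <_) (sym y≡1+x) ≤-refl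

    copied⇔equal : ∀ {x y} → toℕ y ≡ suc (toℕ x) → (P y ≡ true) ⇔ (X x ≡ X y)
    copied⇔equal y≡1+x = mk⇔ (copied⇒equal y≡1+x) λ Xx≡Xy → ¬-not λ Py → free⇒distinct y≡1+x Py Xx≡Xy

foldr-⊓-≤ : ∀ {A : Set} (f : A → ℕ) (z : ℕ) {xs : List A} {x} → x ∈ xs → foldr (λ y acc → f y ⊓ acc) z xs ≤ f x
foldr-⊓-≤ f z {y ∷ _}  (here refl)  = m⊓n≤m (f y) _
foldr-⊓-≤ f z {y ∷ xs} (there x∈xs) = ≤-trans (m⊓n≤n (f y) _) (foldr-⊓-≤ f z x∈xs)

foldr-⊓-greatest : ∀ {A : Set} (f : A → ℕ) {z v : ℕ} (xs : List A) → v ≤ z → (∀ {x} → x ∈ xs → v ≤ f x) →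
  v ≤ foldr (λ y acc → f y ⊓ acc) z xs
foldr-⊓-greatest f []       v≤z v≤f = v≤z
foldr-⊓-greatest f (y ∷ xs) v≤z v≤f = ⊓-glb (v≤f (here refl)) (foldr-⊓-greatest f xs v≤z (v≤f ∘ there))

foldr-⊔-≥ : ∀ {A : Set} (f : A → ℕ) (z : ℕ) {xs : List A} {x} → x ∈ xs → f x ≤ foldr (λ y acc → f y ⊔ acc) z xs
foldr-⊔-≥ f z {y ∷ _}  (here refl)  = m≤m⊔n (f y) _
foldr-⊔-≥ f z {y ∷ xs} (there x∈xs) = ≤-trans (foldr-⊔-≥ f z x∈xs) (m≤n⊔m (f y) _)

foldr-⊔-least : ∀ {A : Set} (f : A → ℕ) {z v : ℕ} (xs : List A) → z ≤ v → (∀ {x} → x ∈ xs → f x ≤ v) →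
  foldr (λ y acc → f y ⊔ acc) z xs ≤ v
foldr-⊔-least f []       z≤v f≤v = z≤v
foldr-⊔-least f (y ∷ xs) z≤v f≤v = ⊔-lub (f≤v (here refl)) (foldr-⊔-least f xs z≤v (f≤v ∘ there))

select-0-∈ : ∀ {A : Set} {xs : List A} {x} → select 0 xs ≡ just x → x ∈ xs
select-0-∈ {xs = _ ∷ _} refl = here refl

select-0-filter-filter-tabulate : ∀ {A : Set} {n} (g : Fin n → A) (r q : A → Bool) (x : Fin n) →
  T (r (g x)) → T (q (g x)) → (∀ p → toℕ p < toℕ x → T (r (g p)) → ¬ T (q (g p))) →
  select 0 (filter (T? ∘ q) (filter (T? ∘ r) (tabulate g))) ≡ just (g x)
select-0-filter-filter-tabulate g r q fzero rx qx earlier with r (g fzero)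
... | true with q (g fzero)
...   | true = refl
select-0-filter-filter-tabulate g r q (fsuc x) rx qx earlier with r (g fzero) in r₀
... | false = select-0-filter-filter-tabulate (g ∘ fsuc) r q x rx qx (λ p → earlier (fsuc p) ∘ s≤s)
... | true with q (g fzero) in q₀
...   | true  = ⊥-elim (earlier fzero (s≤s z≤n) (subst T (sym r₀) _) (subst T (sym q₀) _))
...   | false = select-0-filter-filter-tabulate (g ∘ fsuc) r q x rx qx (λ p → earlier (fsuc p) ∘ s≤s)

module _ {n : ℕ} where

  inRange : Fin n → Fin n → Fin n → Bool
  inRange i j p = (toℕ i ≤ᵇ toℕ p) ∧ (toℕ p ≤ᵇ toℕ j)

  inRange-intro : ∀ {i j p} → toℕ i ≤ toℕ p → toℕ p ≤ toℕ j → T (inRange i j p)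
  inRange-intro i≤p p≤j = Equivalence.from T-∧ (≤⇒≤ᵇ i≤p , ≤⇒≤ᵇ p≤j)

  inRange-elim : ∀ i j {p} → T (inRange i j p) → toℕ i ≤ toℕ p × toℕ p ≤ toℕ j
  inRange-elim i j {p} t with Equivalence.to T-∧ t
  ... | i≤ᵇp , p≤ᵇj = ≤ᵇ⇒≤ (toℕ i) (toℕ p) i≤ᵇp , ≤ᵇ⇒≤ (toℕ p) (toℕ j) p≤ᵇj

  ∈-range⁺ : ∀ {i j p} → toℕ i ≤ toℕ p → toℕ p ≤ toℕ j → p ∈ range i j
  ∈-range⁺ {i} {j} {p} i≤p p≤j = ∈-filter⁺ (T? ∘ inRange i j) (∈-allFin p) (inRange-intro i≤p p≤j)

  ∈-range⁻ : ∀ i j {p} → p ∈ range i j → toℕ i ≤ toℕ p × toℕ p ≤ toℕ j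
  ∈-range⁻ i j p∈ = inRange-elim i j (proj₂ (∈-filter⁻ (T? ∘ inRange i j) {xs = allFin n} p∈))

module Queries {n : ℕ} (X : Array n) where

  RMin-minimal : ∀ {i j x p} → RMin X i j 1 ≡ just x → p ∈ range i j → X x ≤ X p
  RMin-minimal {i} {j} {x} RMin≡x p∈ =
    subst (_≤ X _) (sym (≡ᵇ⇒≡ (X x) (minIn X i j) isMin)) (foldr-⊓-≤ X (X i) p∈)
    where
    isMin : T (X x ≡ᵇ minIn X i j)
    isMin = proj₂ (∈-filter⁻ (λ p → T? (X p ≡ᵇ minIn X i j)) {xs = range i j} (select-0-∈ RMin≡x))

  RMax-maximal : ∀ {i j x p} → RMax X i j 1 ≡ just x → p ∈ range i j → X p ≤ X x
  RMax-maximal {i} {j} {x} RMax≡x p∈ =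
    subst (X _ ≤_) (sym (≡ᵇ⇒≡ (X x) (maxIn X i j) isMax)) (foldr-⊔-≥ X (X i) p∈)
    where
    isMax : T (X x ≡ᵇ maxIn X i j)
    isMax = proj₂ (∈-filter⁻ (λ p → T? (X p ≡ᵇ maxIn X i j)) {xs = range i j} (select-0-∈ RMax≡x))

  private
    nothing-before : ∀ {i j : Fin n} p → toℕ p < toℕ i → T (inRange i j p) → ⊥
    nothing-before {i} {j} p p<i inR = <⇒≱ p<i (proj₁ (inRange-elim i j inR))

  RMin-leftmost : ∀ {i j} → toℕ i ≤ toℕ j → (∀ p → toℕ i ≤ toℕ p → toℕ p ≤ toℕ j → X i ≤ X p) →
    RMin X i j 1 ≡ just i
  RMin-leftmost {i} {j} i≤j Xi≤ = select-0-filter-filter-tabulate id (inRange i j)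
    (λ p → X p ≡ᵇ minIn X i j) i (inRange-intro ≤-refl i≤j) (≡⇒≡ᵇ (X i) _ (sym minIn≡Xi))
    (λ p p<i inR _ → nothing-before {i} {j} p p<i inR)
    where
    minIn≡Xi : minIn X i j ≡ X i
    minIn≡Xi = ≤-antisym (foldr-⊓-≤ X (X i) (∈-range⁺ ≤-refl i≤j))
      (foldr-⊓-greatest X (range i j) ≤-refl λ p∈ → uncurry (Xi≤ _) (∈-range⁻ i j p∈))

  RMax-leftmost : ∀ {i j} → toℕ i ≤ toℕ j → (∀ p → toℕ i ≤ toℕ p → toℕ p ≤ toℕ j → X p ≤ X i) →
    RMax X i j 1 ≡ just i
  RMax-leftmost {i} {j} i≤j ≤Xi = select-0-filter-filter-tabulate id (inRange i j)
    (λ p → X p ≡ᵇ maxIn X i j) i (inRange-intro ≤-refl i≤j) (≡⇒≡ᵇ (X i) _ (sym maxIn≡Xi))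
    (λ p p<i inR _ → nothing-before {i} {j} p p<i inR)
    where
    maxIn≡Xi : maxIn X i j ≡ X i
    maxIn≡Xi = ≤-antisym
      (foldr-⊔-least X (range i j) ≤-refl λ p∈ → uncurry (≤Xi _) (∈-range⁻ i j p∈))
      (foldr-⊔-≥ X (X i) (∈-range⁺ ≤-refl i≤j))

  RMax-strict-rightmost : ∀ {i j} → toℕ i ≤ toℕ j → (∀ p → toℕ i ≤ toℕ p → toℕ p < toℕ j → X p < X j) →
    RMax X i j 1 ≡ just j
  RMax-strict-rightmost {i} {j} i≤j <Xj = select-0-filter-filter-tabulate id (inRange i j)
    (λ p → X p ≡ᵇ maxIn X i j) j (inRange-intro i≤j ≤-refl) (≡⇒≡ᵇ (X j) _ (sym maxIn≡Xj))
    (λ p p<j inR isMax → <-irrefl (trans (≡ᵇ⇒≡ (X p) _ isMax) maxIn≡Xj)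
                                   (<Xj p (proj₁ (inRange-elim i j inR)) p<j))
    where
    ≤Xj : ∀ p → toℕ i ≤ toℕ p → toℕ p ≤ toℕ j → X p ≤ X j
    ≤Xj p i≤p p≤j with m≤n⇒m<n∨m≡n p≤j
    ... | inj₁ p<j = <⇒≤ (<Xj p i≤p p<j)
    ... | inj₂ p≡j = ≤-reflexive (cong X (toℕ-injective p≡j))
    maxIn≡Xj : maxIn X i j ≡ X j
    maxIn≡Xj = ≤-antisym
      (foldr-⊔-least X (range i j) (≤Xj i ≤-refl i≤j) λ p∈ → uncurry (≤Xj _) (∈-range⁻ i j p∈))
      (foldr-⊔-≥ X (X i) (∈-range⁺ i≤j ≤-refl))

  equal⇔leftmost-extrema : ∀ {i j} → toℕ j ≡ suc (toℕ i) →
    (X i ≡ X j) ⇔ (RMin X i j 1 ≡ just i × RMax X i j 1 ≡ just i)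
  equal⇔leftmost-extrema {i} {j} j≡1+i = mk⇔
    (λ Xi≡Xj → RMin-leftmost i≤j (λ p i≤p p≤j → ≤-reflexive (sym (constant Xi≡Xj p i≤p p≤j)))
             , RMax-leftmost i≤j (λ p i≤p p≤j → ≤-reflexive (constant Xi≡Xj p i≤p p≤j)))
    (λ { (RMin≡i , RMax≡i) → ≤-antisym (RMin-minimal RMin≡i (∈-range⁺ i≤j ≤-refl))
                                       (RMax-maximal RMax≡i (∈-range⁺ i≤j ≤-refl)) })
    where
    i≤j : toℕ i ≤ toℕ j
    i≤j = subst (toℕ i ≤_) (sym j≡1+i) (n≤1+n _)
    constant : X i ≡ X j → ∀ p → toℕ i ≤ toℕ p → toℕ p ≤ toℕ j → X p ≡ X i
    constant Xi≡Xj p i≤p p≤j with m≤n⇒m<n∨m≡n p≤j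
    ... | inj₁ p<j = cong X (toℕ-injective (≤-antisym (s≤s⁻¹ (subst (toℕ p <_) j≡1+i p<j)) i≤p))
    ... | inj₂ p≡j = trans (cong X (toℕ-injective p≡j)) (sym Xi≡Xj)

open Queries

QueriesAgree : ∀ {n} → Array n → Array n → Set
QueriesAgree {n} X Y = (i j : Fin n) → toℕ i ≤ toℕ j → RMin X i j 1 ≡ RMin Y i j 1 × RMax X i j 1 ≡ RMax Y i j 1

QueriesAgree-sym : ∀ {n} {X Y : Array n} → QueriesAgree X Y → QueriesAgree Y X
QueriesAgree-sym agree i j i≤j = sym (proj₁ (agree i j i≤j)) , sym (proj₂ (agree i j i≤j))

Within : ℕ → ℕ → (ℕ → Set) → Set
Within r s Q = ∀ k → r < k → k < s → Q k

within-extend : ∀ {r s} {Q : ℕ → Set} → Within r s Q → Q s → Within r (suc s) Q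
within-extend allQ Qs k r<k k<1+s with m<1+n⇒m<n∨m≡n k<1+s
... | inj₁ k<s  = allQ k r<k k<s
... | inj₂ refl = Qs

within-extend-or-switch : ∀ {r s} {Q Q' : ℕ → Set} → r < s → Within r s Q → Q' s →
  Within r (suc s) Q' ⊎ Σ ℕ λ k → r < k × suc k < suc s × Q k × Q' (suc k)
within-extend-or-switch {s = suc k} {Q' = Q'} r<1+k allQ Q's with m<1+n⇒m<n∨m≡n r<1+k
... | inj₁ r<k  = inj₂ (k , r<k , ≤-refl , allQ k r<k ≤-refl , Q's)
... | inj₂ refl = inj₁ λ t r<t t<2+r → subst Q' (≤-antisym r<t (s≤s⁻¹ t<2+r)) Q's

monochromatic-or-switching : ∀ {L H : ℕ → Set} r s → Within r s (λ k → L k ⊎ H k) →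
  Within r s H ⊎ Within r s L ⊎ Σ ℕ λ k → r < k × suc k < s × (H k × L (suc k) ⊎ L k × H (suc k))
monochromatic-or-switching r zero colour = inj₁ λ _ _ ()
monochromatic-or-switching r (suc s) colour with r <? s
... | no r≮s = inj₁ λ k r<k k<1+s → ⊥-elim (r≮s (<-≤-trans r<k (s≤s⁻¹ k<1+s)))
... | yes r<s
  with monochromatic-or-switching r s (λ k r<k k<s → colour k r<k (m<n⇒m<1+n k<s)) | colour s r<s ≤-refl
... | inj₁ allH               | inj₂ Hs = inj₁ (within-extend allH Hs)
... | inj₂ (inj₁ allL)        | inj₁ Ls = inj₂ (inj₁ (within-extend allL Ls))
... | inj₂ (inj₂ (k , r<k , 1+k<s , switch)) | _ = inj₂ (inj₂ (k , r<k , m<n⇒m<1+n 1+k<s , switch))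
... | inj₁ allH               | inj₁ Ls with within-extend-or-switch r<s allH Ls
...   | inj₁ allL                         = inj₂ (inj₁ allL)
...   | inj₂ (k , r<k , 1+k<1+s , Hk , L) = inj₂ (inj₂ (k , r<k , 1+k<1+s , inj₁ (Hk , L)))
monochromatic-or-switching r (suc s) colour | yes r<s | inj₂ (inj₁ allL) | inj₂ Hs
  with within-extend-or-switch r<s allL Hs
...   | inj₁ allH                         = inj₁ allH
...   | inj₂ (k , r<k , 1+k<1+s , Lk , H) = inj₂ (inj₂ (k , r<k , 1+k<1+s , inj₂ (Lk , H)))

module _ {m : ℕ} where

  Avoids-2-41-3 : (Fin m → ℕ) → Set
  Avoids-2-41-3 f = ∀ a b b' c → toℕ a < toℕ b → toℕ b' ≡ suc (toℕ b) → toℕ b' < toℕ c →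
    ¬ (f b' < f a × f a < f c × f c < f b)

  Avoids-3-14-2 : (Fin m → ℕ) → Set
  Avoids-3-14-2 f = ∀ a b b' c → toℕ a < toℕ b → toℕ b' ≡ suc (toℕ b) → toℕ b' < toℕ c →
    ¬ (f b < f c × f c < f a × f a < f b')

  MinLeftTransfers : (f g : Fin m → ℕ) → Set
  MinLeftTransfers f g = ∀ r s → toℕ r < toℕ s →
    (∀ t → toℕ r ≤ toℕ t → toℕ t ≤ toℕ s → f r ≤ f t) → g r ≤ g s

  MaxRightTransfers : (f g : Fin m → ℕ) → Set
  MaxRightTransfers f g = ∀ r s → toℕ r < toℕ s →
    (∀ t → toℕ r ≤ toℕ t → toℕ t < toℕ s → f t < f s) → g r ≤ g s

  Baxter⇒avoids-2-41-3 : ∀ π → IsBaxter π → Avoids-2-41-3 (value π)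
  Baxter⇒avoids-2-41-3 π baxter a b b' c a<b b'≡1+b b'<c = proj₁ (baxter a b b' c a<b b'≡1+b b'<c)

  Baxter⇒avoids-3-14-2 : ∀ π → IsBaxter π → Avoids-3-14-2 (value π)
  Baxter⇒avoids-3-14-2 π baxter a b b' c a<b b'≡1+b b'<c = proj₂ (baxter a b b' c a<b b'≡1+b b'<c)

module _ {m : ℕ} {f g : Fin m → ℕ}
  (f-injective : ∀ {r s} → f r ≡ f s → r ≡ s) (g-injective : ∀ {r s} → g r ≡ g s → r ≡ s)
  (f-avoids : Avoids-2-41-3 f) (g-avoids : Avoids-3-14-2 g)
  (minLeft : MinLeftTransfers f g) (maxRight : MaxRightTransfers f g) where

  module Inversion {r s : Fin m} (r<s : toℕ r < toℕ s)
    (IH : ∀ {x y} → toℕ y ∸ toℕ x < toℕ s ∸ toℕ r → toℕ x < toℕ y → f x < f y → g x < g y)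
    (fr<fs : f r < f s) (gs<gr : g s < g r) where

    outside : ∀ t → toℕ r < toℕ t → toℕ t < toℕ s → f t < f r ⊎ f s < f t
    outside t r<t t<s with <-cmp (f t) (f r) | <-cmp (f t) (f s)
    ... | tri< ft<fr _ _ | _              = inj₁ ft<fr
    ... | _              | tri> _ _ fs<ft = inj₂ fs<ft
    ... | tri≈ _ ft≡fr _ | _              = ⊥-elim (<⇒≢ r<t (cong toℕ (sym (f-injective ft≡fr))))
    ... | _              | tri≈ _ ft≡fs _ = ⊥-elim (<⇒≢ t<s (cong toℕ (f-injective ft≡fs)))
    ... | tri> _ _ fr<ft | tri< ft<fs _ _ = ⊥-elim (<-asym gs<gr (<-trans
      (IH (∸-monoˡ-< t<s (<⇒≤ r<t)) r<t fr<ft) (IH (∸-monoʳ-< r<t (<⇒≤ t<s)) t<s ft<fs)))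

    -- Indexed by ℕ so that the scan of monochromatic-or-switching runs over the integers of (r, s).
    Low High : ℕ → Set
    Low  k = ∀ t → toℕ t ≡ k → f t < f r
    High k = ∀ t → toℕ t ≡ k → f s < f t

    fin : ∀ {k} → k < toℕ s → Fin m
    fin k<s = fromℕ< (<-trans k<s (toℕ<n s))

    toℕ-fin : ∀ {k} (k<s : k < toℕ s) → toℕ (fin k<s) ≡ k
    toℕ-fin k<s = toℕ-fromℕ< (<-trans k<s (toℕ<n s))

    colour : Within (toℕ r) (toℕ s) (λ k → Low k ⊎ High k)
    colour k r<k k<s with outside (fin k<s) (subst (toℕ r <_) (sym (toℕ-fin k<s)) r<k)
                                          (subst (_< toℕ s) (sym (toℕ-fin k<s)) k<s)
    ... | inj₁ low  = inj₁ λ t t≡k → subst (λ u → f u < f r) (toℕ-injective (trans (toℕ-fin k<s) (sym t≡k))) low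
    ... | inj₂ high = inj₂ λ t t≡k → subst (λ u → f s < f u) (toℕ-injective (trans (toℕ-fin k<s) (sym t≡k))) high

    not-all-high : ¬ Within (toℕ r) (toℕ s) High
    not-all-high allHigh = <⇒≱ gs<gr (minLeft r s r<s fr≤)
      where
      fr≤ : ∀ t → toℕ r ≤ toℕ t → toℕ t ≤ toℕ s → f r ≤ f t
      fr≤ t r≤t t≤s with m≤n⇒m<n∨m≡n r≤t | m≤n⇒m<n∨m≡n t≤s
      ... | inj₂ r≡t | _        = ≤-reflexive (cong f (toℕ-injective r≡t))
      ... | inj₁ r<t | inj₂ t≡s = subst (λ u → f r ≤ f u) (toℕ-injective (sym t≡s)) (<⇒≤ fr<fs)
      ... | inj₁ r<t | inj₁ t<s = <⇒≤ (<-trans fr<fs (allHigh (toℕ t) r<t t<s t refl))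

    not-all-low : ¬ Within (toℕ r) (toℕ s) Low
    not-all-low allLow = <⇒≱ gs<gr (maxRight r s r<s <fs)
      where
      <fs : ∀ t → toℕ r ≤ toℕ t → toℕ t < toℕ s → f t < f s
      <fs t r≤t t<s with m≤n⇒m<n∨m≡n r≤t
      ... | inj₂ r≡t = subst (λ u → f u < f s) (toℕ-injective r≡t) fr<fs
      ... | inj₁ r<t = <-trans (allLow (toℕ t) r<t t<s t refl) fr<fs

    no-neighbour-switch : ∀ t t' → toℕ t' ≡ suc (toℕ t) → toℕ r < toℕ t → toℕ t' < toℕ s →
      ¬ ((f s < f t × f t' < f r) ⊎ (f t < f r × f s < f t'))
    no-neighbour-switch t t' t'≡1+t r<t t'<s (inj₁ (fs<ft , ft'<fr)) =
      f-avoids r t t' s r<t t'≡1+t t'<s (ft'<fr , fr<fs , fs<ft)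
    no-neighbour-switch t t' t'≡1+t r<t t'<s (inj₂ (ft<fr , fs<ft')) =
      g-avoids r t t' s r<t t'≡1+t t'<s
        ( IH (∸-monoʳ-< r<t (<⇒≤ t<s)) t<s (<-trans ft<fr fr<fs)
        , gs<gr
        , IH (∸-monoˡ-< t'<s (<⇒≤ r<t')) r<t' (<-trans fr<fs fs<ft'))
      where
      t<t' : toℕ t < toℕ t'
      t<t' = subst (toℕ t <_) (sym t'≡1+t) ≤-refl
      t<s : toℕ t < toℕ s
      t<s = <-trans t<t' t'<s
      r<t' : toℕ r < toℕ t'
      r<t' = <-trans r<t t<t'

    no-switch : ¬ Σ ℕ λ k → toℕ r < k × suc k < toℕ s × (High k × Low (suc k) ⊎ Low k × High (suc k))
    no-switch (k , r<k , 1+k<s , switch) =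
      no-neighbour-switch (fin k<s) (fin 1+k<s) (trans (toℕ-fin 1+k<s) (cong suc (sym (toℕ-fin k<s))))
        (subst (toℕ r <_) (sym (toℕ-fin k<s)) r<k) (subst (_< toℕ s) (sym (toℕ-fin 1+k<s)) 1+k<s)
        (⊎-map (λ (Hk , L1+k) → Hk _ (toℕ-fin k<s) , L1+k _ (toℕ-fin 1+k<s))
              (λ (Lk , H1+k) → Lk _ (toℕ-fin k<s) , H1+k _ (toℕ-fin 1+k<s)) switch)
      where
      k<s : k < toℕ s
      k<s = <-trans (n<1+n k) 1+k<s

    impossible : ⊥
    impossible = [ not-all-high , [ not-all-low , no-switch ] ] (monochromatic-or-switching (toℕ r) (toℕ s) colour)

  ascents-preserved : ∀ {r s} → toℕ r < toℕ s → f r < f s → g r < g s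
  ascents-preserved {r} {s} = <-rec GapClaim step (toℕ s ∸ toℕ r) refl
    where
    GapClaim : ℕ → Set
    GapClaim d = ∀ {x y} → toℕ y ∸ toℕ x ≡ d → toℕ x < toℕ y → f x < f y → g x < g y
    step : ∀ d → (∀ {d'} → d' < d → GapClaim d') → GapClaim d
    step d IH {x} {y} refl x<y fx<fy with <-cmp (g x) (g y)
    ... | tri< gx<gy _ _ = gx<gy
    ... | tri≈ _ gx≡gy _ = ⊥-elim (<⇒≢ x<y (cong toℕ (g-injective gx≡gy)))
    ... | tri> _ _ gy<gx = ⊥-elim (Inversion.impossible x<y (λ smaller → IH smaller refl) fx<fy gy<gx)

order-preserved : ∀ {m} {f g : Fin m → ℕ} →
  (∀ {r s} → f r ≡ f s → r ≡ s) → (∀ {r s} → g r ≡ g s → r ≡ s) →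
  Avoids-2-41-3 f → Avoids-3-14-2 f → Avoids-2-41-3 g → Avoids-3-14-2 g →
  MinLeftTransfers f g → MaxRightTransfers f g → MinLeftTransfers g f → MaxRightTransfers g f →
  ∀ {r s} → f r < f s → g r < g s
order-preserved {f = f} {g} f-inj g-inj f-2413 f-3142 g-2413 g-3142 minˡ-fg maxʳ-fg minˡ-gf maxʳ-gf {r} {s} fr<fs
  with <-cmp (toℕ r) (toℕ s) | <-cmp (g r) (g s)
... | tri< r<s _ _ | _ = ascents-preserved f-inj g-inj f-2413 g-3142 minˡ-fg maxʳ-fg r<s fr<fs
... | tri≈ _ r≡s _ | _ = ⊥-elim (<-irrefl (cong f (toℕ-injective r≡s)) fr<fs)
... | tri> _ _ s<r | tri< gr<gs _ _ = gr<gs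
... | tri> _ _ s<r | tri≈ _ gr≡gs _ = ⊥-elim (<-irrefl (cong f (g-inj gr≡gs)) fr<fs)
... | tri> _ _ s<r | tri> _ _ gs<gr =
  ⊥-elim (<-asym fr<fs (ascents-preserved g-inj f-inj g-2413 f-3142 minˡ-gf maxʳ-gf s<r gs<gr))

strictly-increasing⇒inflationary : ∀ {m} (h : Fin m → Fin m) →
  (∀ {v w} → toℕ v < toℕ w → toℕ (h v) < toℕ (h w)) → ∀ v → toℕ v ≤ toℕ (h v)
strictly-increasing⇒inflationary {m} h h-mono v = go (toℕ v) v refl
  where
  go : ∀ k v → toℕ v ≡ k → k ≤ toℕ (h v)
  go zero    v _      = z≤n
  go (suc k) v v≡1+k  = <-≤-trans (s≤s (go k u (toℕ-fromℕ< k<m))) (h-mono u<v)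
    where
    k<m : k < m
    k<m = <-trans (n<1+n k) (subst (_< m) v≡1+k (toℕ<n v))
    u : Fin m
    u = fromℕ< k<m
    u<v : toℕ u < toℕ v
    u<v = subst₂ _<_ (sym (toℕ-fromℕ< k<m)) (sym v≡1+k) ≤-refl

value-≤ : ∀ {m} (π σ : Permutation′ m) →
  (∀ {r s} → value π r < value π s → value σ r < value σ s) → ∀ r → value π r ≤ value σ r
value-≤ π σ preserved r = subst (λ u → value π r ≤ value σ u) (inverseˡ π)
  (strictly-increasing⇒inflationary (λ v → σ ⟨$⟩ʳ (π ⟨$⟩ˡ v)) increasing (π ⟨$⟩ʳ r))
  where
  increasing : ∀ {v w} → toℕ v < toℕ w → value σ (π ⟨$⟩ˡ v) < value σ (π ⟨$⟩ˡ w)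
  increasing v<w = preserved (subst₂ (λ a b → toℕ a < toℕ b) (sym (inverseʳ π)) (sym (inverseʳ π)) v<w)

module _ {n : ℕ} {P : Fin n → Bool} (firstFree : FirstFree P) {m : ℕ} (m≡ : m ≡ countFree P) where
  open Ranks P firstFree m≡

  module _ {π σ : Permutation′ m} {X Y : Array n} (valuedX : ValuedBy P π X) (valuedY : ValuedBy P σ Y)
    (agree : QueriesAgree X Y) where

    module VX = Valued valuedX
    module VY = Valued valuedY

    minLeft-transfers : MinLeftTransfers (value π) (value σ)
    minLeft-transfers r s r<s πr≤ =
      s≤s⁻¹ (subst₂ _≤_ (VY.valued-position r) (VY.valued-position s)
        (RMin-minimal Y RMinY≡a (∈-range⁺ a≤c ≤-refl)))
      where
      a c : Fin n
      a = position r
      c = position s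
      a≤c : toℕ a ≤ toℕ c
      a≤c = <⇒≤ (position-mono-< r<s)
      Xa≤ : ∀ p → toℕ a ≤ toℕ p → toℕ p ≤ toℕ c → X a ≤ X p
      Xa≤ p a≤p p≤c = subst₂ _≤_ (sym (VX.valued-position r)) (sym (VX.valued-rank p))
        (s≤s (πr≤ (rank p) (position≤⇒≤rank a≤p) (≤position⇒rank≤ p≤c)))
      RMinY≡a : RMin Y a c 1 ≡ just a
      RMinY≡a = trans (sym (proj₁ (agree a c a≤c))) (RMin-leftmost X a≤c Xa≤)

    maxRight-transfers : MaxRightTransfers (value π) (value σ)
    maxRight-transfers r s r<s <πs =
      s≤s⁻¹ (subst₂ _≤_ (VY.valued-position r) (VY.valued-position s)
        (RMax-maximal Y RMaxY≡c (∈-range⁺ ≤-refl a≤c)))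
      where
      a c : Fin n
      a = position r
      c = position s
      a≤c : toℕ a ≤ toℕ c
      a≤c = <⇒≤ (position-mono-< r<s)
      <Xc : ∀ p → toℕ a ≤ toℕ p → toℕ p < toℕ c → X p < X c
      <Xc p a≤p p<c = subst₂ _<_ (sym (VX.valued-rank p)) (sym (VX.valued-position s))
        (s≤s (<πs (rank p) (position≤⇒≤rank a≤p) (<position⇒rank< p<c)))
      RMaxY≡c : RMax Y a c 1 ≡ just c
      RMaxY≡c = trans (sym (proj₂ (agree a c a≤c))) (RMax-strict-rightmost X a≤c <Xc)

  order-preserved-by-queries : ∀ {π σ : Permutation′ m} {X Y : Array n} → IsBaxter π → IsBaxter σ →
    ValuedBy P π X → ValuedBy P σ Y → QueriesAgree X Y →
    ∀ {r s} → value π r < value π s → value σ r < value σ s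
  order-preserved-by-queries {π} {σ} {X} {Y} baxterπ baxterσ valuedX valuedY agree =
    order-preserved (value-injective π) (value-injective σ)
      (Baxter⇒avoids-2-41-3 π baxterπ) (Baxter⇒avoids-3-14-2 π baxterπ)
      (Baxter⇒avoids-2-41-3 σ baxterσ) (Baxter⇒avoids-3-14-2 σ baxterσ)
      (minLeft-transfers valuedX valuedY agree) (maxRight-transfers valuedX valuedY agree)
      (minLeft-transfers valuedY valuedX (QueriesAgree-sym {X = X} {Y} agree))
      (maxRight-transfers valuedY valuedX (QueriesAgree-sym {X = X} {Y} agree))

  same-layout⇒equal : ∀ {π σ : Permutation′ m} {X Y : Array n} → IsBaxter π → IsBaxter σ →
    ValuedBy P π X → ValuedBy P σ Y → QueriesAgree X Y → ∀ p → X p ≡ Y p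
  same-layout⇒equal {π} {σ} {X} {Y} baxterπ baxterσ valuedX valuedY agree p = begin
    X p                      ≡⟨ Valued.valued-rank valuedX p ⟩
    suc (value π (rank p))   ≡⟨ cong suc (≤-antisym (value-≤ π σ π→σ (rank p)) (value-≤ σ π σ→π (rank p))) ⟩
    suc (value σ (rank p))   ≡⟨ Valued.valued-rank valuedY p ⟨
    Y p                      ∎
    where
    open ≡-Reasoning
    π→σ : ∀ {r s} → value π r < value π s → value σ r < value σ s
    π→σ = order-preserved-by-queries baxterπ baxterσ valuedX valuedY agree
    σ→π : ∀ {r s} → value σ r < value σ s → value π r < value π s
    σ→π = order-preserved-by-queries baxterσ baxterπ valuedY valuedX (QueriesAgree-sym {X = X} {Y} agree)

copies-determined : ∀ {n m m'} {P Q : Fin n → Bool} {π : Permutation′ m} {σ : Permutation′ m'} {X Y : Array n}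
  (firstFreeP : FirstFree P) (firstFreeQ : FirstFree Q) (m≡ : m ≡ countFree P) (m'≡ : m' ≡ countFree Q) →
  ValuedBy P π X → ValuedBy Q σ Y → QueriesAgree X Y → ∀ j → P j ≡ Q j
copies-determined {suc n} firstFreeP firstFreeQ _ _ _ _ _ fzero =
  trans (firstFreeP fzero refl) (sym (firstFreeQ fzero refl))
copies-determined {suc n} {P = P} {Q} {X = X} {Y} firstFreeP firstFreeQ m≡ m'≡ valuedX valuedY agree (fsuc j) =
  ⇔→≡ (⇔-trans (Ranks.Valued.copied⇔equal P firstFreeP m≡ valuedX j≡1+i)
      (⇔-trans (equal⇔leftmost-extrema X j≡1+i)
      (⇔-trans extrema-agree
      (⇔-trans (⇔-sym (equal⇔leftmost-extrema Y j≡1+i))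
               (⇔-sym (Ranks.Valued.copied⇔equal Q firstFreeQ m'≡ valuedY j≡1+i))))))
  where
  i : Fin (suc n)
  i = inject₁ j
  j≡1+i : toℕ (fsuc j) ≡ suc (toℕ i)
  j≡1+i = cong suc (sym (toℕ-inject₁ j))
  extrema-agree : (RMin X i (fsuc j) 1 ≡ just i × RMax X i (fsuc j) 1 ≡ just i)
                ⇔ (RMin Y i (fsuc j) 1 ≡ just i × RMax Y i (fsuc j) 1 ≡ just i)
  extrema-agree with agree i (fsuc j) (subst (toℕ i ≤_) (sym j≡1+i) (n≤1+n _))
  ... | RMin≡ , RMax≡ rewrite RMin≡ | RMax≡ = ⇔-refl

theorem4 : (n : ℕ) → 2 ≤ n → (A B : Array n) → InA n A → InA n B →
    ((i j : Fin n) → toℕ i ≤ toℕ j → (q : ℕ) → 1 ≤ q →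
       (RMin A i j q ≡ RMin B i j q) × (RMax A i j q ≡ RMax B i j q)) →
    (p : Fin n) → A p ≡ B p
theorem4 n _ A B (P , m , π , firstFreeP , m≡ , baxterπ , valuedA) (Q , m' , σ , firstFreeQ , m'≡ , baxterσ , valuedB) queries =
  aligned (trans m≡ (trans (countFree-cong P≗Q) (sym m'≡))) σ baxterσ (ValuedBy-cong P≗Q valuedB′)
  where
  agree : QueriesAgree A B
  agree i j i≤j = queries i j i≤j 1 (s≤s z≤n)
  valuedA′ : ValuedBy P π A
  valuedA′ = valuedBy valuedA
  valuedB′ : ValuedBy Q σ B
  valuedB′ = valuedBy valuedB
  P≗Q : ∀ j → P j ≡ Q j
  P≗Q = copies-determined firstFreeP firstFreeQ m≡ m'≡ valuedA′ valuedB′ agree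
  aligned : ∀ {m''} → m ≡ m'' → (τ : Permutation′ m'') → IsBaxter τ → ValuedBy P τ B → ∀ p → A p ≡ B p
  aligned refl τ baxterτ valuedB″ = same-layout⇒equal firstFreeP m≡ baxterπ baxterτ valuedA′ valuedB″ agree
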